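{- Let $a=\sum_{i\ge0}a_i3^i\in\mathbb Z_3$ with $a_i\in\{0,1,2\}$, and write $2a=\sum_{i\ge0}c_i3^i$ with $c_i\in\{0,1,2\}$. Then $c_0\equiv -a_0\pmod3$ and for $t\ge1$, $$c_t\equiv -a_t+\sum_{i=0}^{t-1}a_i(1-a_i)\prod_{j=i+1}^{t-1}a_j(2a_j-1)\pmod 3.$$
   Context: An empty product equals $1$. -}

module Defs where

open import Data.Nat using (ℕ; zero; suc; _∸_; _^_)
open import Data.Integer using (ℤ; +_; _+_; _-_; _*_)

-- A 3-adic integer a = Σ_{i≥0} a_i 3^i is represented by its digit
-- sequence a : ℕ → ℕ (with the side condition a i < 3 stated where used).

sumℤ : ℕ → (ℕ → ℤ) → ℤ
sumℤ zero    f = + 0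
sumℤ (suc n) f = sumℤ n f + f n

prodℤ : ℕ → (ℕ → ℤ) → ℤ
prodℤ zero    f = + 1
prodℤ (suc n) f = prodℤ n f * f n

-- Π_{j=m}^{n-1} f j  (empty, = 1, when n ≤ m)
prodRange : ℕ → ℕ → (ℕ → ℤ) → ℤ
prodRange m n f = prodℤ (n ∸ m) (λ k → f (m Data.Nat.+ k))

trunc : ℕ → (ℕ → ℕ) → ℤ
trunc n a = sumℤ n (λ i → + (a i) * + (3 ^ i))

-- The congruences force c to be the digit sequence produced by schoolbook
-- doubling of a, whose carries k_t ∈ {0,1} satisfy c_t = 2a_t + k_t − 3k_{t+1};
-- hence c_t + a_t ≡ k_t (mod 3).
-- Modulo 3 the carry obeys k_{t+1} ≡ k_t·p(a_t) + g(a_t), where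
-- p(x) = x(2x−1) is 1 exactly when a digit propagates a carry and
-- g(x) = x(1−x) is 1 exactly when it generates one.  Unrolling this
-- linear recurrence from k_0 = 0 gives the carry-lookahead sum
-- k_t = Σ_{i<t} g(a_i) Π_{i<j<t} p(a_j).
module Submission where

open import Defs
open import Data.Nat using (ℕ; _<_; _≤_; _∸_; _^_)
open import Data.Integer using (ℤ; +_; _+_; _-_; _*_)
open import Data.Integer.Divisibility using (_∣_)
open import Data.Product using (_×_)

import Data.Nat as N
open N using (zero; suc; s≤s; NonZero; _/_; _%_)
open import Data.Nat.DivMod
  using (m≡m%n+[m/n]*n; m<n⇒m%n≡m; m<n*o⇒m/o<n; %-remove-+ʳ)
open import Data.Nat.Divisibility using () renaming (_∣_ to _∣ℕ_)
import Data.Nat.Properties as NP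
open import Data.Integer using (-_; _⊖_; ∣_∣)
import Data.Integer.Properties as ℤ
import Data.Integer.Divisibility as ℤᵤ
open import Data.Integer.Divisibility.Signed
  using (divides; ∣m∣n⇒∣m+n; ∣m⇒∣m*n; ∣⇒∣ᵤ)
  renaming (_∣_ to _∣ₛ_)
open import Data.Integer.Tactic.RingSolver using (solve-∀)
open import Data.Product using (_,_)
open import Function using (_∘_)
open import Data.Sum using (inj₁; inj₂)
open import Relation.Binary.PropositionalEquality
  using (_≡_; refl; sym; trans; cong; cong₂; subst; subst₂; module ≡-Reasoning)

open ≡-Reasoning

%-≡-of-∣∸ : ∀ {d m n} .{{_ : NonZero d}} → m ≤ n → d ∣ℕ n ∸ m → m % d ≡ n % d
%-≡-of-∣∸ {d} {m} {n} m≤n d∣n∸m = begin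
  m % d               ≡⟨ %-remove-+ʳ m d∣n∸m ⟨
  (m N.+ (n ∸ m)) % d ≡⟨ cong (_% d) (NP.m+[n∸m]≡n m≤n) ⟩
  n % d               ∎

%-≡-of-∣⊖∣ : ∀ {d} m n .{{_ : NonZero d}} → d ∣ℕ ∣ m ⊖ n ∣ → m % d ≡ n % d
%-≡-of-∣⊖∣ m n d∣ with NP.≤-total m n
... | inj₁ m≤n = %-≡-of-∣∸ m≤n (subst (_ ∣ℕ_) (ℤ.∣⊖∣-≤ m≤n) d∣)
... | inj₂ n≤m = sym (%-≡-of-∣∸ n≤m
  (subst (_ ∣ℕ_) (trans (ℤ.∣m⊖n∣≡∣n⊖m∣ m n) (ℤ.∣⊖∣-≤ n≤m)) d∣))

value : ℕ → ℕ → (ℕ → ℕ) → ℤ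
value b n a = sumℤ n (λ i → + a i * + (b ^ i))

pos-^-suc : ∀ b t → + (b ^ suc t) ≡ + (b ^ t) * + b
pos-^-suc b t = trans (ℤ.pos-* b (b ^ t)) (ℤ.*-comm (+ b) (+ (b ^ t)))

module LongMultiplication (b m : ℕ) .{{_ : NonZero b}} (a : ℕ → ℕ) where

  carry : ℕ → ℕ
  carry zero    = 0
  carry (suc t) = (m N.* a t N.+ carry t) / b

  digit : ℕ → ℕ
  digit t = (m N.* a t N.+ carry t) % b

  digit+carry*base : ∀ t → + digit t + + carry (suc t) * + b ≡ + m * + a t + + carry t
  digit+carry*base t = begin
    + digit t + + carry (suc t) * + b   ≡⟨ cong (λ x → + digit t + x) (ℤ.pos-* (carry (suc t)) b) ⟨
    + (digit t N.+ carry (suc t) N.* b) ≡⟨ cong +_ (m≡m%n+[m/n]*n (m N.* a t N.+ carry t) b) ⟨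
    + (m N.* a t N.+ carry t)           ≡⟨ cong (_+ + carry t) (ℤ.pos-* m (a t)) ⟩
    + m * + a t + + carry t             ∎

  value-scaled : ∀ t → + m * value b t a ≡ value b t digit + + carry t * + (b ^ t)
  value-scaled zero    = ℤ.*-zeroʳ (+ m)
  value-scaled (suc t) = begin
    + m * (A + + a t * B)
      ≡⟨ distrib (+ m) A (+ a t) B ⟩
    + m * A + + m * + a t * B
      ≡⟨ cong (_+ + m * + a t * B) (value-scaled t) ⟩
    D + + carry t * B + + m * + a t * B
      ≡⟨ regroup D (+ carry t) (+ m * + a t) B ⟩
    D + (+ m * + a t + + carry t) * B
      ≡⟨ cong (λ x → D + x * B) (digit+carry*base t) ⟨
    D + (+ digit t + + carry (suc t) * + b) * B
      ≡⟨ split D (+ digit t) (+ carry (suc t)) (+ b) B ⟩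
    D + + digit t * B + + carry (suc t) * (B * + b)
      ≡⟨ cong (λ x → D + + digit t * B + + carry (suc t) * x) (pos-^-suc b t) ⟨
    D + + digit t * B + + carry (suc t) * + (b ^ suc t) ∎
    where
    A = value b t a
    D = value b t digit
    B = + (b ^ t)
    distrib : ∀ m A a B → m * (A + a * B) ≡ m * A + m * a * B
    distrib = solve-∀
    regroup : ∀ D k x B → D + k * B + x * B ≡ D + (x + k) * B
    regroup = solve-∀
    split : ∀ D d k b B → D + (d + k * b) * B ≡ D + d * B + k * (B * b)
    split = solve-∀

  digit-unique : ∀ {c t} → c < b →
                 + b ∣ (+ c - (+ m * + a t + + carry t)) → c ≡ digit t
  digit-unique {c} {t} c<b b∣ = begin
    c     ≡⟨ m<n⇒m%n≡m c<b ⟨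
    c % b ≡⟨ %-≡-of-∣⊖∣ c x (subst (λ z → b ∣ℕ ∣ z ∣) c-x≡c⊖x b∣) ⟩
    x % b ∎
    where
    x = m N.* a t N.+ carry t
    c-x≡c⊖x : + c - (+ m * + a t + + carry t) ≡ c ⊖ x
    c-x≡c⊖x = begin
      + c - (+ m * + a t + + carry t) ≡⟨ cong (λ z → + c - (z + + carry t)) (ℤ.pos-* m (a t)) ⟨
      + c - + x                       ≡⟨ ℤ.m-n≡m⊖n c x ⟩
      c ⊖ x                           ∎

  carry<multiplier : .{{_ : NonZero m}} → (∀ i → a i < b) → ∀ t → carry t < m
  carry<multiplier a<b zero    = N.>-nonZero⁻¹ m
  carry<multiplier a<b (suc t) =
    m<n*o⇒m/o<n (NP.<-≤-trans (NP.+-monoʳ-< (m N.* a t) (carry<multiplier a<b t)) m*a+m≤m*b)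
    where
    m*a+m≤m*b : m N.* a t N.+ m ≤ m N.* b
    m*a+m≤m*b = subst (_≤ m N.* b) (trans (NP.*-suc m (a t)) (NP.+-comm m (m N.* a t)))
                      (NP.*-monoʳ-≤ m (a<b t))

  module _ (c : ℕ → ℕ) (c<b : ∀ i → c i < b)
           (scaled : ∀ n → + (b ^ n) ∣ (value b n c - + m * value b n a)) where

    digit-determined : ∀ t → value b t c ≡ value b t digit → c t ≡ digit t
    digit-determined t same-prefix = digit-unique (c<b t) (ℤᵤ.*-cancelˡ-∣ B B*b∣B*err)
      where
      instance
        b^t≢0 : NonZero (b ^ t)
        b^t≢0 = NP.m^n≢0 b t
      B = + (b ^ t)
      err = + c t - (+ m * + a t + + carry t)
      factor : ∀ V c B m A a → V + c * B - m * (A + a * B) ≡ V - m * A + B * (c - m * a)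
      factor = solve-∀
      cancel : ∀ D k B c x → D - (D + k * B) + B * (c - x) ≡ B * (c - (x + k))
      cancel = solve-∀
      error-at-t : value b (suc t) c - + m * value b (suc t) a ≡ B * err
      error-at-t = begin
        value b t c + + c t * B - + m * (value b t a + + a t * B)
          ≡⟨ factor (value b t c) (+ c t) B (+ m) (value b t a) (+ a t) ⟩
        value b t c - + m * value b t a + B * (+ c t - + m * + a t)
          ≡⟨ cong₂ (λ u v → u - v + B * (+ c t - + m * + a t)) same-prefix (value-scaled t) ⟩
        value b t digit - (value b t digit + + carry t * B) + B * (+ c t - + m * + a t)
          ≡⟨ cancel (value b t digit) (+ carry t) B (+ c t) (+ m * + a t) ⟩
        B * err ∎
      B*b∣B*err : B * + b ∣ B * err
      B*b∣B*err = subst₂ _∣_ (pos-^-suc b t) error-at-t (scaled (suc t))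

    same-value : ∀ t → value b t c ≡ value b t digit
    same-value zero    = refl
    same-value (suc t) =
      cong₂ (λ u d → u + + d * + (b ^ t)) (same-value t) (digit-determined t (same-value t))

    digits-unique : ∀ t → c t ≡ digit t
    digits-unique t = digit-determined t (same-value t)

sumℤ-cong : ∀ n {f g : ℕ → ℤ} → (∀ {i} → i < n → f i ≡ g i) → sumℤ n f ≡ sumℤ n g
sumℤ-cong zero    f≡g = refl
sumℤ-cong (suc n) f≡g = cong₂ _+_ (sumℤ-cong n (λ i<n → f≡g (NP.m<n⇒m<1+n i<n))) (f≡g NP.≤-refl)

sumℤ-*ʳ : ∀ n (f : ℕ → ℤ) x → sumℤ n (λ i → f i * x) ≡ sumℤ n f * x
sumℤ-*ʳ zero    f x = refl
sumℤ-*ʳ (suc n) f x = trans (cong (_+ f n * x) (sumℤ-*ʳ n f x)) (sym (ℤ.*-distribʳ-+ x (sumℤ n f) (f n)))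

prodRange-suc : ∀ {m n} f → m ≤ n → prodRange m (suc n) f ≡ prodRange m n f * f n
prodRange-suc {m} {n} f m≤n rewrite NP.+-∸-assoc 1 m≤n | NP.m+[n∸m]≡n m≤n = refl

prodRange-empty : ∀ n f → prodRange (n N.+ 1) (suc n) f ≡ + 1
prodRange-empty n f rewrite NP.+-comm n 1 | NP.n∸n≡0 n = refl

lookahead : (ℕ → ℤ) → (ℕ → ℤ) → ℕ → ℤ
lookahead p g t = sumℤ t (λ i → g i * prodRange (i N.+ 1) t p)

lookahead-suc : ∀ p g t → lookahead p g (suc t) ≡ lookahead p g t * p t + g t
lookahead-suc p g t = cong₂ _+_ older newest
  where
  older : sumℤ t (λ i → g i * prodRange (i N.+ 1) (suc t) p) ≡ lookahead p g t * p t
  older = begin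
    sumℤ t (λ i → g i * prodRange (i N.+ 1) (suc t) p)
      ≡⟨ sumℤ-cong t (λ {i} i<t → trans
           (cong (g i *_) (prodRange-suc p (subst (_≤ t) (NP.+-comm 1 i) i<t)))
           (sym (ℤ.*-assoc (g i) _ (p t)))) ⟩
    sumℤ t (λ i → g i * prodRange (i N.+ 1) t p * p t)
      ≡⟨ sumℤ-*ʳ t (λ i → g i * prodRange (i N.+ 1) t p) (p t) ⟩
    lookahead p g t * p t ∎
  newest : g t * prodRange (t N.+ 1) (suc t) p ≡ g t
  newest = trans (cong (g t *_) (prodRange-empty t p)) (ℤ.*-identityʳ (g t))

propagate : ℕ → ℤ
propagate x = + x * (+ 2 * + x - + 1)

generate : ℕ → ℤ
generate x = + x * (+ 1 - + x)

doubling-carry-mod-3 : ∀ x k → x < 3 → k ≤ 1 →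
                       + 3 ∣ₛ + ((2 N.* x N.+ k) / 3) - (+ k * propagate x + generate x)
doubling-carry-mod-3 0 0 _ _ = divides (+ 0) refl
doubling-carry-mod-3 0 1 _ _ = divides (+ 0) refl
doubling-carry-mod-3 1 0 _ _ = divides (+ 0) refl
doubling-carry-mod-3 1 1 _ _ = divides (+ 0) refl
doubling-carry-mod-3 2 0 _ _ = divides (+ 1) refl
doubling-carry-mod-3 2 1 _ _ = divides (- + 1) refl
doubling-carry-mod-3 (suc (suc (suc _))) _ (s≤s (s≤s (s≤s ()))) _
doubling-carry-mod-3 _ (suc (suc _)) _ (s≤s ())

module Doubling (a : ℕ → ℕ) (a<3 : ∀ i → a i < 3) where

  open LongMultiplication 3 2 a

  lookaheadSum : ℕ → ℤ
  lookaheadSum = lookahead (propagate ∘ a) (generate ∘ a)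

  carry≤1 : ∀ t → carry t ≤ 1
  carry≤1 t = N.s≤s⁻¹ (carry<multiplier a<3 t)

  carry≡lookahead-mod-3 : ∀ t → + 3 ∣ₛ + carry t - lookaheadSum t
  carry≡lookahead-mod-3 zero    = divides (+ 0) refl
  carry≡lookahead-mod-3 (suc t) =
    subst (+ 3 ∣ₛ_) (sym split)
      (∣m∣n⇒∣m+n (∣m⇒∣m*n (propagate (a t)) (carry≡lookahead-mod-3 t))
                 (doubling-carry-mod-3 (a t) (carry t) (a<3 t) (carry≤1 t)))
    where
    regroup : ∀ k k′ L p g → k′ - (L * p + g) ≡ (k - L) * p + (k′ - (k * p + g))
    regroup = solve-∀
    split : + carry (suc t) - lookaheadSum (suc t)
          ≡ (+ carry t - lookaheadSum t) * propagate (a t)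
            + (+ carry (suc t) - (+ carry t * propagate (a t) + generate (a t)))
    split = trans (cong (λ L → + carry (suc t) - L) (lookahead-suc (propagate ∘ a) (generate ∘ a) t))
                  (regroup (+ carry t) (+ carry (suc t)) (lookaheadSum t) (propagate (a t)) (generate (a t)))

  digit+a≡carry-mod-3 : ∀ t → + 3 ∣ₛ (+ digit t + + a t) - + carry t
  digit+a≡carry-mod-3 t = divides (+ a t - + carry (suc t)) (begin
    + digit t + + a t - + carry t
      ≡⟨ isolate (+ digit t) (+ a t) (+ carry t) (+ carry (suc t)) ⟩
    (+ digit t + + carry (suc t) * + 3) + + a t - + carry t - + carry (suc t) * + 3
      ≡⟨ cong (λ x → x + + a t - + carry t - + carry (suc t) * + 3) (digit+carry*base t) ⟩
    (+ 2 * + a t + + carry t) + + a t - + carry t - + carry (suc t) * + 3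
      ≡⟨ collect (+ a t) (+ carry t) (+ carry (suc t)) ⟩
    (+ a t - + carry (suc t)) * + 3 ∎)
    where
    isolate : ∀ d x k k′ → d + x - k ≡ (d + k′ * + 3) + x - k - k′ * + 3
    isolate = solve-∀
    collect : ∀ x k k′ → (+ 2 * x + k) + x - k - k′ * + 3 ≡ (x - k′) * + 3
    collect = solve-∀

  module _ (c : ℕ → ℕ) (c<3 : ∀ i → c i < 3)
           (doubled : ∀ n → + (3 ^ n) ∣ (value 3 n c - + 2 * value 3 n a)) where

    c+a≡lookahead-mod-3 : ∀ t → + 3 ∣ₛ (+ c t + + a t) - lookaheadSum t
    c+a≡lookahead-mod-3 t =
      subst (λ d → + 3 ∣ₛ (+ d + + a t) - lookaheadSum t)
            (sym (digits-unique c c<3 doubled t))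
            (subst (+ 3 ∣ₛ_) (collapse (+ digit t + + a t) (+ carry t) (lookaheadSum t))
              (∣m∣n⇒∣m+n (digit+a≡carry-mod-3 t) (carry≡lookahead-mod-3 t)))
      where
      collapse : ∀ x k L → x - k + (k - L) ≡ x - L
      collapse = solve-∀

corollary2p6 : (a c : ℕ → ℕ) →
    (∀ i → a i < 3) → (∀ i → c i < 3) →
    (∀ n → + (3 ^ n) ∣ (trunc n c - + 2 * trunc n a)) →
    (+ 3 ∣ (+ (c 0) + + (a 0)))
    × (∀ t → 1 ≤ t →
        + 3 ∣ ((+ (c t) + + (a t))
               - sumℤ t (λ i → (+ (a i) * (+ 1 - + (a i)))
                   * prodRange (Data.Nat._+_ i 1) t
                       (λ j → + (a j) * (+ 2 * + (a j) - + 1)))))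
corollary2p6 a c a<3 c<3 doubled =
  subst (+ 3 ∣_) (ℤ.+-identityʳ (+ c 0 + + a 0)) (∣⇒∣ᵤ (c+a≡lookahead-mod-3 c c<3 doubled 0)) ,
  λ t _ → ∣⇒∣ᵤ (c+a≡lookahead-mod-3 c c<3 doubled t)
  where open Doubling a a<3 using (c+a≡lookahead-mod-3)
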